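{- Let $p$ be a prime, let $k, l$ be positive odd integers, and let $n := p^k$ and $m := p^l$. Consider the group $G := \mathbb{Z}_n \times \mathbb{Z}_m$. There is a generating pair $S_1, S_2$ for $G$ such that $|S_1| = |S_2| = \sqrt{nm}$.
   Context: For an abelian group $G$ written additively, a pair of subsets $S_1, S_2 \subseteq G$ is a generating pair for $G$ if $S_1 + S_2 := \{x + y : x \in S_1, y \in S_2\}$ equals $G$. -}

module Defs where

open import Data.Nat using (ℕ; suc; NonZero)
import Data.Nat as ℕ
open import Data.Nat.DivMod using (_mod_)
open import Data.Fin using (Fin; toℕ)
open import Data.Product using (_×_; _,_; ∃; ∃-syntax)
open import Data.List using (List; length)
open import Data.List.Membership.Propositional using (_∈_)
open import Data.List.Relation.Unary.Unique.Propositional using (Unique)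
open import Relation.Binary.PropositionalEquality using (_≡_)

addℤ : (n : ℕ) .{{_ : NonZero n}} → Fin n → Fin n → Fin n
addℤ n a b = (toℕ a ℕ.+ toℕ b) mod n

G : ℕ → ℕ → Set
G n m = Fin n × Fin m

addG : (n m : ℕ) .{{_ : NonZero n}} .{{_ : NonZero m}} → G n m → G n m → G n m
addG n m (a , b) (c , d) = addℤ n a c , addℤ m b d

record FinSubset (A : Set) : Set where
  constructor finSubset
  field
    elems  : List A
    unique : Unique elems

open FinSubset public

∣_∣ : {A : Set} → FinSubset A → ℕ
∣ S ∣ = length (elems S)

IsGeneratingPair : (n m : ℕ) .{{_ : NonZero n}} .{{_ : NonZero m}} →
                   FinSubset (G n m) → FinSubset (G n m) → Set
IsGeneratingPair n m S₁ S₂ =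
  (g : G n m) → ∃[ x ] ∃[ y ] (x ∈ elems S₁ × y ∈ elems S₂ × addG n m x y ≡ g)

module Submission where

-- A generating pair of ℤ_{ab} of sizes a and b is given by base-a digits: the residues
-- {0, …, a − 1} together with the multiples {0, a, …, (b − 1)a}. Generating pairs of two
-- groups multiply to one of their product. For n = p^(2k′+1) and m = p^(2l′+1) split
-- n = p^(k′+1) · p^k′ and m = p^l′ · p^(l′+1); pairing the large factor of ℤ_n with the small
-- one of ℤ_m gives two sets of size p^(k′+l′+1) = √(nm) each.

open import Defs
open import Data.Nat using (ℕ; _+_; _*_; _^_; NonZero; _<_; _≤_)
open import Data.Nat.Properties
  using (m^n≢0; m≤m*n; *-monoˡ-<; *-cancelʳ-≡; *-comm; ^-distribˡ-+-*; <-≤-trans; ≤-reflexive)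
open import Data.Nat.Primality using (Prime; prime⇒nonZero)
open import Data.Nat.DivMod using (_%_; _/_; m%n<n; m<n*o⇒m/o<n; m<n⇒m%n≡m; m≡m%n+[m/n]*n)
open import Data.Nat.Tactic.RingSolver using (solve-∀)
open import Data.Fin using (Fin; toℕ; fromℕ<)
open import Data.Fin.Properties using (toℕ-fromℕ<; toℕ-injective; toℕ<n)
open import Data.List using (List; []; _∷_; _++_; length; tabulate; cartesianProduct; map)
open import Data.List.Properties using (length-tabulate; length-++; length-map)
open import Data.List.Membership.Propositional using (_∈_)
open import Data.List.Membership.Propositional.Properties using (∈-tabulate⁺; ∈-cartesianProduct⁺)
open import Data.List.Relation.Unary.Unique.Propositional.Properties using (tabulate⁺; cartesianProduct⁺)
open import Data.Product using (_×_; ∃-syntax; _,_)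
open import Relation.Binary.PropositionalEquality using (_≡_; refl; sym; trans; cong; cong₂; subst)
open Relation.Binary.PropositionalEquality.≡-Reasoning

IsGeneratingPairℤ : (n : ℕ) .{{_ : NonZero n}} → FinSubset (Fin n) → FinSubset (Fin n) → Set
IsGeneratingPairℤ n S T =
  (g : Fin n) → ∃[ s ] ∃[ t ] (s ∈ elems S × t ∈ elems T × addℤ n s t ≡ g)

length-cartesianProduct : {A B : Set} (xs : List A) (ys : List B) →
                          length (cartesianProduct xs ys) ≡ length xs * length ys
length-cartesianProduct []       ys = refl
length-cartesianProduct (x ∷ xs) ys = begin
  length (map (x ,_) ys ++ cartesianProduct xs ys)        ≡⟨ length-++ (map (x ,_) ys) ⟩
  length (map (x ,_) ys) + length (cartesianProduct xs ys) ≡⟨ cong₂ _+_ (length-map (x ,_) ys)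
                                                                       (length-cartesianProduct xs ys) ⟩
  length ys + length xs * length ys                        ∎

_⊗_ : {A B : Set} → FinSubset A → FinSubset B → FinSubset (A × B)
S ⊗ U = finSubset (cartesianProduct (elems S) (elems U)) (cartesianProduct⁺ (unique S) (unique U))

∣⊗∣ : {A B : Set} (S : FinSubset A) (U : FinSubset B) → ∣ S ⊗ U ∣ ≡ ∣ S ∣ * ∣ U ∣
∣⊗∣ S U = length-cartesianProduct (elems S) (elems U)

×-generatingPair : {n m : ℕ} .{{_ : NonZero n}} .{{_ : NonZero m}}
                   (S T : FinSubset (Fin n)) (U V : FinSubset (Fin m)) →
                   IsGeneratingPairℤ n S T → IsGeneratingPairℤ m U V →
                   IsGeneratingPair n m (S ⊗ U) (T ⊗ V)
×-generatingPair S T U V genST genUV (x , y) with genST x | genUV y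
... | s , t , s∈S , t∈T , s+t≡x | u , v , u∈U , v∈V , u+v≡y =
  (s , u) , (t , v) , ∈-cartesianProduct⁺ s∈S u∈U , ∈-cartesianProduct⁺ t∈T v∈V ,
  cong₂ _,_ s+t≡x u+v≡y

module Digits (n a b : ℕ) .{{_ : NonZero n}} {{_ : NonZero a}} {{_ : NonZero b}}
              (ab≡n : a * b ≡ n) where

  low< : (i : Fin a) → toℕ i < n
  low< i = <-≤-trans (toℕ<n i) (subst (a ≤_) ab≡n (m≤m*n a b))

  high< : (j : Fin b) → toℕ j * a < n
  high< j = <-≤-trans (*-monoˡ-< a (toℕ<n j)) (≤-reflexive (trans (*-comm b a) ab≡n))

  low : Fin a → Fin n
  low i = fromℕ< (low< i)

  high : Fin b → Fin n
  high j = fromℕ< (high< j)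

  toℕ-low : (i : Fin a) → toℕ (low i) ≡ toℕ i
  toℕ-low i = toℕ-fromℕ< (low< i)

  toℕ-high : (j : Fin b) → toℕ (high j) ≡ toℕ j * a
  toℕ-high j = toℕ-fromℕ< (high< j)

  low-injective : ∀ {i j} → low i ≡ low j → i ≡ j
  low-injective {i} {j} eq =
    toℕ-injective (trans (sym (toℕ-low i)) (trans (cong toℕ eq) (toℕ-low j)))

  high-injective : ∀ {i j} → high i ≡ high j → i ≡ j
  high-injective {i} {j} eq = toℕ-injective (*-cancelʳ-≡ (toℕ i) (toℕ j) a
    (trans (sym (toℕ-high i)) (trans (cong toℕ eq) (toℕ-high j))))

  lowDigits : FinSubset (Fin n)
  lowDigits = finSubset (tabulate low) (tabulate⁺ low-injective)

  highDigits : FinSubset (Fin n)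
  highDigits = finSubset (tabulate high) (tabulate⁺ high-injective)

  digits-decompose : (x : ℕ) → x < n → ∃[ i ] ∃[ j ] toℕ (low i) + toℕ (high j) ≡ x
  digits-decompose x x<n = r , q , (begin
    toℕ (low r) + toℕ (high q) ≡⟨ cong₂ _+_ (trans (toℕ-low r) (toℕ-fromℕ< x%a<a))
                                           (trans (toℕ-high q) (cong (_* a) (toℕ-fromℕ< x/a<b))) ⟩
    x % a + x / a * a          ≡⟨ sym (m≡m%n+[m/n]*n x a) ⟩
    x                          ∎)
    where
    x%a<a : x % a < a
    x%a<a = m%n<n x a
    x/a<b : x / a < b
    x/a<b = m<n*o⇒m/o<n {x} {b} {a} (<-≤-trans x<n (≤-reflexive (sym (trans (*-comm b a) ab≡n))))
    r : Fin a
    r = fromℕ< x%a<a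
    q : Fin b
    q = fromℕ< x/a<b

  digits-generate : IsGeneratingPairℤ n lowDigits highDigits
  digits-generate g with digits-decompose (toℕ g) (toℕ<n g)
  ... | i , j , low+high≡g = low i , high j , ∈-tabulate⁺ i , ∈-tabulate⁺ j , toℕ-injective (begin
    toℕ (addℤ n (low i) (high j))   ≡⟨ toℕ-fromℕ< (m%n<n (toℕ (low i) + toℕ (high j)) n) ⟩
    (toℕ (low i) + toℕ (high j)) % n ≡⟨ cong (_% n) low+high≡g ⟩
    toℕ g % n                       ≡⟨ m<n⇒m%n≡m (toℕ<n g) ⟩
    toℕ g                           ∎)

ℤ-generatingPair : (n a b : ℕ) .{{_ : NonZero n}} {{_ : NonZero a}} {{_ : NonZero b}} →
                   a * b ≡ n → ∃[ S ] ∃[ T ] (IsGeneratingPairℤ n S T × ∣ S ∣ ≡ a × ∣ T ∣ ≡ b)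
ℤ-generatingPair n a b ab≡n =
  lowDigits , highDigits , digits-generate , length-tabulate low , length-tabulate high
  where open Digits n a b ab≡n

^-split : ∀ p i j {k} → i + j ≡ k → p ^ i * p ^ j ≡ p ^ k
^-split p i j i+j≡k = trans (sym (^-distribˡ-+-* p i j)) (cong (p ^_) i+j≡k)

^-generatingPair : ∀ p .{{_ : NonZero p}} i j {e} → i + j ≡ e →
                   ∃[ S ] ∃[ T ] (IsGeneratingPairℤ (p ^ e) {{m^n≢0 p e}} S T × ∣ S ∣ ≡ p ^ i × ∣ T ∣ ≡ p ^ j)
^-generatingPair p i j {e} i+j≡e =
  ℤ-generatingPair (p ^ e) (p ^ i) (p ^ j) {{m^n≢0 p e}} {{m^n≢0 p i}} {{m^n≢0 p j}} (^-split p i j i+j≡e)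

∣⊗∣-^ : ∀ p {A B : Set} (X : FinSubset A) (Y : FinSubset B) i j →
        ∣ X ∣ ≡ p ^ i → ∣ Y ∣ ≡ p ^ j → ∣ X ⊗ Y ∣ ≡ p ^ (i + j)
∣⊗∣-^ p X Y i j ∣X∣ ∣Y∣ = trans (∣⊗∣ X Y) (trans (cong₂ _*_ ∣X∣ ∣Y∣) (^-split p i j refl))

square-of-^ : ∀ p {x} e k l → x ≡ p ^ e → e + e ≡ k + l → x * x ≡ p ^ k * p ^ l
square-of-^ p e k l refl e+e≡k+l = trans (^-split p e e e+e≡k+l) (^-distribˡ-+-* p k l)

lemma4 : (p k l : ℕ) (pr : Prime p) →
    (k′ l′ : ℕ) → k ≡ 2 * k′ + 1 → l ≡ 2 * l′ + 1 →
    ∃[ S₁ ] ∃[ S₂ ] (IsGeneratingPair (p ^ k) (p ^ l) {{m^n≢0 p k {{prime⇒nonZero pr}}}} {{m^n≢0 p l {{prime⇒nonZero pr}}}} S₁ S₂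
      × ∣ S₁ ∣ * ∣ S₁ ∣ ≡ p ^ k * p ^ l
      × ∣ S₂ ∣ * ∣ S₂ ∣ ≡ p ^ k * p ^ l)
lemma4 p k l pr k′ l′ refl refl =
  let S , T , genST , ∣S∣ , ∣T∣ = ^-generatingPair p (1 + k′) k′ (split k′)
      U , V , genUV , ∣U∣ , ∣V∣ = ^-generatingPair p l′ (1 + l′) (split′ l′)
  in S ⊗ U , T ⊗ V , ×-generatingPair {{m^n≢0 p k}} {{m^n≢0 p l}} S T U V genST genUV ,
     square-of-^ p (1 + k′ + l′) k l (∣⊗∣-^ p S U (1 + k′) l′ ∣S∣ ∣U∣) (balanced k′ l′) ,
     square-of-^ p (k′ + (1 + l′)) k l (∣⊗∣-^ p T V k′ (1 + l′) ∣T∣ ∣V∣) (balanced′ k′ l′)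
  where
  instance
    p≢0 : NonZero p
    p≢0 = prime⇒nonZero pr
  split : ∀ k′ → (1 + k′) + k′ ≡ 2 * k′ + 1
  split = solve-∀
  split′ : ∀ l′ → l′ + (1 + l′) ≡ 2 * l′ + 1
  split′ = solve-∀
  balanced : ∀ k′ l′ → (1 + k′ + l′) + (1 + k′ + l′) ≡ (2 * k′ + 1) + (2 * l′ + 1)
  balanced = solve-∀
  balanced′ : ∀ k′ l′ → (k′ + (1 + l′)) + (k′ + (1 + l′)) ≡ (2 * k′ + 1) + (2 * l′ + 1)
  balanced′ = solve-∀
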